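{- Assume the setting described in the context. For every $v\in\{0,\dots,\tau-1\}$ and every integer $u\ge 1$, $$Q_{v,u}-Q_{v+1,u-1}=l^{\overline{E}_{v+u,u-1}}\,b_{v+u+1,u},$$ and the $\mathbf l$-adic digit $b_{v+u+1,u}$ satisfies $$b_{v+u+1,u}=\frac{l^{e_v}d_{v,u}-d_{v+1,u-1}+b_{v+u,u-1}}{m^{f_{v+u}}}.$$
   Context: Setting. Let $m,l\ge 2$ be coprime integers and $\tau\ge1$ an integer. Let $f_0,\dots,f_{\tau-1}$ be positive integers. Let $(a_{v,i})$, $v\in\{0,\dots,\tau-1\}$, $i\in\{0,\dots,l-1\}$, be integers with $a_{v,0}=0$ and, for $i\neq0$: $a_{v,i}\equiv -m^{f_v}i \pmod l$, $a_{v,i}\not\equiv0\pmod m$ and $a_{v,i}\not\equiv 0\pmod l$. For each $v\in\{0,\dots,\tau-1\}$ fix an admissible choice: an index $i_v\in\{1,\dots,l-1\}$, with $a_v:=a_{v,i_v}$; an integer $s_v$ with $1\le s_v\le m^{f_v}-1$ and $\gcd(s_v,m)=1$; and positive integers $e_v,r_v$ with $r_v\equiv i_v\pmod l$, $l^{e_v}s_v=m^{f_v}r_v+a_v$, and $|a_v|<\max(m^{f_v},l^{e_v})$. All indexed quantities are extended $\tau$-periodically to all integer indices ($f_u=f_{u\bmod\tau}$, $e_u=e_{u\bmod \tau}$, $s_u,r_u,a_u$ likewise). Sums. For $v\in\mathbb Z$, $u\ge0$: $F_{v,u}=\sum_{y=0}^{u-1}f_{v+y}$, $E_{v,u}=\sum_{y=0}^{u-1}e_{v+y}$,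 $\overline{F}_{v,u}=\sum_{y=0}^{u-1}f_{v-1-y}$, $\overline{E}_{v,u}=\sum_{y=0}^{u-1}e_{v-1-y}$. Iterates. Let $\mathbb Z_{\langle m,l\rangle}$ be the subring of $\mathbb Q$ of fractions whose denominators are coprime to both $m$ and $l$ (congruences modulo powers of $m$, $l$ are taken in this ring). Let $(n_v)_{v\in\mathbb Z}$ be a $\tau$-periodic sequence in $\mathbb Z_{\langle m,l\rangle}$ with $n_v\equiv s_v\pmod{m^{f_v}}$ and $n_{v+1}=l^{e_v}\frac{n_v-s_v}{m^{f_v}}+r_v$ for all $v$. Graded digits. For each $v$ define $k_{v,0}=n_v$ and, for $u\ge0$, $k_{v,u}=m^{f_{v+u}}k_{v,u+1}+d_{v,u}$ with $d_{v,u}\in\{0,\dots,m^{f_{v+u}}-1\}$ and $k_{v,u+1}\in\mathbb Z_{\langle m,l\rangle}$ (the $u$-th $\mathbf m$-adic digit and quotient of $n_v$). Define $j_{v,0}=n_v$ and $j_{v,u}=l^{e_{v-1-u}}j_{v,u+1}+b_{v,u}$ with $b_{v,u}\in\{0,\dots,l^{e_{v-1-u}}-1\}$ and $j_{v,u+1}\in\mathbb Z_{\langle m,l\rangle}$ (the $u$-th $\mathbf l$-adic digit and quotient of $n_v$). Prefix addends. $Q_{v,0}=0$ and for $u\ge1$, $Q_{v,u}=\dfrac{l^{E_{v,u}}d_{v,u}+l^{e_{v+u-1}}Q_{v,u-1}-s_{v+u}+r_{v+u-1}}{m^{f_{v+u}}}$. -}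

module Defs where

open import Data.Nat as ℕ using (ℕ; zero; suc)
open import Data.Integer as ℤ using (ℤ; +_)
open import Data.Rational as ℚ using (ℚ)
open import Data.Nat.Coprimality using (Coprime)

ℕ→ℚ : ℕ → ℚ
ℕ→ℚ n = (+ n) ℚ./ 1

ℤ→ℚ : ℤ → ℚ
ℤ→ℚ z = z ℚ./ 1

-- division of a rational by a natural number; the value at 0 is a
-- junk convention (never used: all divisors below are m^f or l^e with m,l ≥ 2)
_divℕ_ : ℚ → ℕ → ℚ
x divℕ zero = ℚ.0ℚ
x divℕ suc n = x ℚ.* ((+ 1) ℚ./ suc n)

-- membership in the ring ℤ_⟨m,l⟩ ⊆ ℚ : reduced denominator coprime to m and to l
InR : ℕ → ℕ → ℚ → Set
InR m l x = Coprime (ℚ.↧ₙ x) m × Coprime (ℚ.↧ₙ x) l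
  where open import Data.Product using (_×_)

CongR : ℕ → ℕ → ℕ → ℚ → ℚ → Set
CongR m l M x y = InR m l ((x ℚ.- y) divℕ M)

sumF : (ℤ → ℕ) → ℤ → ℕ → ℕ
sumF e v zero = 0
sumF e v (suc u) = sumF e v u ℕ.+ e (v ℤ.+ + u)

sumFbar : (ℤ → ℕ) → ℤ → ℕ → ℕ
sumFbar e v zero = 0
sumFbar e v (suc u) = sumFbar e v u ℕ.+ e (v ℤ.- + 1 ℤ.- + u)

Qadd : (m l : ℕ) (f e s r : ℤ → ℕ) (d : ℤ → ℕ → ℕ) → ℤ → ℕ → ℚ
Qadd m l f e s r d v zero = ℚ.0ℚ
Qadd m l f e s r d v (suc u) =
  (ℕ→ℚ (l ℕ.^ sumF e v (suc u) ℕ.* d v (suc u))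
    ℚ.+ ℕ→ℚ (l ℕ.^ e (v ℤ.+ + u)) ℚ.* Qadd m l f e s r d v u
    ℚ.- ℕ→ℚ (s (v ℤ.+ + suc u))
    ℚ.+ ℕ→ℚ (r (v ℤ.+ + u)))
  divℕ (m ℕ.^ f (v ℤ.+ + suc u))

module Submission where

-- Write Φ_w = (n_w - s_w)/m^{f_w}, so that n_{w+1} = l^{e_w} Φ_w + r_w.
-- All quantities live in ℚ; integrality is detected through "denominators coprime to p":
-- a rational with such a denominator whose product with p^f is an integer is itself an
-- integer (denCoprime-integral).  This yields uniqueness of base-p^f digit expansions
-- (digit-unique), which drives the whole argument:
--   1. the 0-th m-adic digit of n_v is s_v and its quotient is Φ_v (first-digit);
--   2. unrolling the recursion, Φ_{v+u} = l^{E_{v,u}} k_{v,u+1} + Q_{v,u} (Φ-expansion);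
--   3. the carries c_{v,u} = k_{v+1,u} - l^{e_v} k_{v,u+1} satisfy c_{v,0} = r_v and
--      m^{f_{v+u+1}} c_{v,u+1} = c_{v,u} - d_{v+1,u} + l^{e_v} d_{v,u+1} (carry-step), hence by
--      induction they are digits 0 ≤ c_{v,u} < l^{e_v} (carry-digit; r_v < l^{e_v} is
--      remainder-bound, a consequence of the admissibility conditions on a_v);
--   4. consequently k_{v+1,u} = l^{e_v} k_{v,u+1} + c_{v,u} is an l-adic digit step, and
--      induction on u gives j_{v+u,u} = k_{v,u} and b_{v+u+1,u} = c_{v,u} (l-adic-step).
-- The two claims of the theorem are then step 2 at (v,u) and (v+1,u-1) subtracted, and
-- the carry recursion of step 3, rewritten with b in place of c.

open import Defs
open import Data.Nat as ℕ using (ℕ; zero; suc; _^_; _∸_)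
open import Data.Integer as ℤ using (ℤ; +_)
open import Data.Integer.Divisibility as ℤD using ()
open import Data.Rational as ℚ using (ℚ)
open import Data.Nat.Coprimality using (Coprime)
open import Data.Product using (_×_)
open import Relation.Nullary using (¬_)
open import Relation.Binary.PropositionalEquality using (_≡_)

import Data.Nat.Properties as ℕP
import Data.Nat.Divisibility as ℕD
import Data.Nat.Coprimality as Coprimality
open import Data.Integer using (-[1+_])
import Data.Integer.Properties as ℤP
import Data.Integer.Divisibility.Signed as ℤDS
open import Data.Rational using (mkℚ)
import Data.Rational.Properties as ℚP
open import Data.Rational.Unnormalised as ℚᵘ using (mkℚᵘ; *≡*)
import Data.Rational.Unnormalised.Properties as ℚᵘP
open import Data.Rational.Solver using (module +-*-Solver)
open import Data.Integer.Tactic.RingSolver using () renaming (solve to solveℤ)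
open import Data.Nat.Tactic.RingSolver using () renaming (solve to solveℕ)
open import Data.List using (_∷_; [])
open import Data.Product using (Σ; _,_; proj₁; proj₂)
open import Data.Sum using (_⊎_; inj₁; inj₂)
open import Data.Empty using (⊥; ⊥-elim)
open import Relation.Nullary using (yes; no)
open import Relation.Binary.PropositionalEquality
  using (refl; sym; trans; cong; cong₂; subst; module ≡-Reasoning)

open +-*-Solver using (solve; _:+_; _:*_; _:-_; _:=_)

-- ι is Defs.ℤ→ℚ; note that ℕ→ℚ n is ι (+ n) by definition.
ι : ℤ → ℚ
ι = ℤ→ℚ

toℚᵘ-ι : ∀ z → ℚ.toℚᵘ (ι z) ℚᵘ.≃ mkℚᵘ z 0
toℚᵘ-ι z = ℚP.toℚᵘ-fromℚᵘ (mkℚᵘ z 0)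

ι-+ : ∀ a b → ι (a ℤ.+ b) ≡ ι a ℚ.+ ι b
ι-+ a b = ℚP.toℚᵘ-injective (ℚᵘP.≃-trans (toℚᵘ-ι (a ℤ.+ b)) (ℚᵘP.≃-trans unnormalised
  (ℚᵘP.≃-sym (ℚᵘP.≃-trans (ℚP.toℚᵘ-homo-+ (ι a) (ι b)) (ℚᵘP.+-cong (toℚᵘ-ι a) (toℚᵘ-ι b))))))
  where
  unnormalised : mkℚᵘ (a ℤ.+ b) 0 ℚᵘ.≃ (mkℚᵘ a 0 ℚᵘ.+ mkℚᵘ b 0)
  unnormalised = *≡* (cong (ℤ._* + 1) (cong₂ ℤ._+_ (sym (ℤP.*-identityʳ a)) (sym (ℤP.*-identityʳ b))))

ι-* : ∀ a b → ι (a ℤ.* b) ≡ ι a ℚ.* ι b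
ι-* a b = ℚP.toℚᵘ-injective (ℚᵘP.≃-trans (toℚᵘ-ι (a ℤ.* b)) (ℚᵘP.≃-trans (*≡* refl)
  (ℚᵘP.≃-sym (ℚᵘP.≃-trans (ℚP.toℚᵘ-homo-* (ι a) (ι b)) (ℚᵘP.*-cong (toℚᵘ-ι a) (toℚᵘ-ι b))))))

ι-neg : ∀ a → ι (ℤ.- a) ≡ ℚ.- ι a
ι-neg a = ℚP.toℚᵘ-injective (ℚᵘP.≃-trans (toℚᵘ-ι (ℤ.- a))
  (ℚᵘP.≃-sym (ℚᵘP.≃-trans (ℚP.toℚᵘ-homo‿- (ι a)) (ℚᵘP.-‿cong (toℚᵘ-ι a)))))

ι-- : ∀ a b → ι (a ℤ.- b) ≡ ι a ℚ.- ι b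
ι-- a b = trans (ι-+ a (ℤ.- b)) (cong (ι a ℚ.+_) (ι-neg b))

ι-injective : ∀ {a b} → ι a ≡ ι b → a ≡ b
ι-injective {a} {b} eq
  with ℚᵘP.≃-trans (ℚᵘP.≃-sym (toℚᵘ-ι a)) (ℚᵘP.≃-trans (ℚP.toℚᵘ-cong eq) (toℚᵘ-ι b))
... | *≡* a*1≡b*1 = trans (sym (ℤP.*-identityʳ a)) (trans a*1≡b*1 (ℤP.*-identityʳ b))

ι-ℕ* : ∀ a b → ι (+ (a ℕ.* b)) ≡ ι (+ a) ℚ.* ι (+ b)
ι-ℕ* a b = trans (cong ι (ℤP.pos-* a b)) (ι-* (+ a) (+ b))

ι-*-inverse : ∀ n → ι (+ suc n) ℚ.* (+ 1 ℚ./ suc n) ≡ ℚ.1ℚ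
ι-*-inverse n = ℚP.toℚᵘ-injective (ℚᵘP.≃-trans (ℚP.toℚᵘ-homo-* (ι (+ suc n)) (+ 1 ℚ./ suc n))
  (ℚᵘP.≃-trans (ℚᵘP.*-cong (toℚᵘ-ι (+ suc n)) (ℚP.toℚᵘ-fromℚᵘ (mkℚᵘ (+ 1) n)))
    (ℚᵘP.≃-trans unnormalised (ℚᵘP.≃-sym (toℚᵘ-ι (+ 1))))))
  where
  unnormalised : (mkℚᵘ (+ suc n) 0 ℚᵘ.* mkℚᵘ (+ 1) n) ℚᵘ.≃ mkℚᵘ (+ 1) 0
  unnormalised = *≡* (cong (λ x → + suc x) (solveℕ (n ∷ [])))

divℕ-*-cancel : ∀ {M} → 0 ℕ.< M → ∀ x → (x divℕ M) ℚ.* ι (+ M) ≡ x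
divℕ-*-cancel {suc n} _ x = begin
  x ℚ.* (+ 1 ℚ./ suc n) ℚ.* ι (+ suc n)   ≡⟨ ℚP.*-assoc x _ _ ⟩
  x ℚ.* ((+ 1 ℚ./ suc n) ℚ.* ι (+ suc n))
    ≡⟨ cong (x ℚ.*_) (trans (ℚP.*-comm _ (ι (+ suc n))) (ι-*-inverse n)) ⟩
  x ℚ.* ℚ.1ℚ                              ≡⟨ ℚP.*-identityʳ x ⟩
  x                                       ∎
  where open ≡-Reasoning

*-divℕ-cancel : ∀ {M} → 0 ℕ.< M → ∀ y → (y ℚ.* ι (+ M)) divℕ M ≡ y
*-divℕ-cancel {suc n} _ y = begin
  y ℚ.* ι (+ suc n) ℚ.* (+ 1 ℚ./ suc n)   ≡⟨ ℚP.*-assoc y _ _ ⟩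
  y ℚ.* (ι (+ suc n) ℚ.* (+ 1 ℚ./ suc n)) ≡⟨ cong (y ℚ.*_) (ι-*-inverse n) ⟩
  y ℚ.* ℚ.1ℚ                              ≡⟨ ℚP.*-identityʳ y ⟩
  y                                       ∎
  where open ≡-Reasoning

divℕ-unique : ∀ {M} → 0 ℕ.< M → ∀ {x y} → x ≡ y ℚ.* ι (+ M) → x divℕ M ≡ y
divℕ-unique M>0 {y = y} refl = *-divℕ-cancel M>0 y

*-cancelʳ-ι : ∀ {M} → 0 ℕ.< M → ∀ {x y} → x ℚ.* ι (+ M) ≡ y ℚ.* ι (+ M) → x ≡ y
*-cancelʳ-ι M>0 {x} eq = trans (sym (*-divℕ-cancel M>0 x)) (divℕ-unique M>0 eq)

coprime-*ˡ : ∀ {a b p} → Coprime a p → Coprime b p → Coprime (a ℕ.* b) p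
coprime-*ˡ {b = b} a⊥p b⊥p (i∣ab , i∣p) =
  b⊥p (Coprimality.coprime-factors a⊥p (i∣ab , ℕD.∣m⇒∣m*n b i∣p) , i∣p)

1-coprime : ∀ {p} → Coprime 1 p
1-coprime (i∣1 , _) = ℕD.∣1⇒≡1 i∣1

^-coprime : ∀ {p q} → Coprime p q → ∀ f → Coprime (p ^ f) q
^-coprime p⊥q zero    = 1-coprime
^-coprime p⊥q (suc f) = coprime-*ˡ p⊥q (^-coprime p⊥q f)

coprime-^ : ∀ {q p} → Coprime q p → ∀ f → Coprime q (p ^ f)
coprime-^ q⊥p f = Coprimality.sym (^-coprime (Coprimality.sym q⊥p) f)

-- Rationals with a denominator coprime to p (a ring containing ℤ_⟨m,l⟩ for p = m, l).

record DenCoprime (p : ℕ) (x : ℚ) : Set where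
  constructor denCoprime
  field
    den         : ℕ
    num         : ℤ
    den-coprime : Coprime den p
    den-pos     : 0 ℕ.< den
    x*den≡num   : x ℚ.* ι (+ den) ≡ ι num

mkℚ-*-denominator : ∀ a q .(c : Coprime ℤ.∣ a ∣ (suc q)) → mkℚ a q c ℚ.* ι (+ suc q) ≡ ι a
mkℚ-*-denominator a q c = ℚP.toℚᵘ-injective
  (ℚᵘP.≃-trans (ℚP.toℚᵘ-homo-* (mkℚ a q c) (ι (+ suc q)))
    (ℚᵘP.≃-trans (ℚᵘP.*-congˡ {mkℚᵘ a q} (toℚᵘ-ι (+ suc q)))
      (ℚᵘP.≃-trans unnormalised (ℚᵘP.≃-sym (toℚᵘ-ι a)))))
  where
  unnormalised : (mkℚᵘ a q ℚᵘ.* mkℚᵘ (+ suc q) 0) ℚᵘ.≃ mkℚᵘ a 0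
  unnormalised = *≡* (trans (ℤP.*-identityʳ _) (cong (a ℤ.*_) (cong +_ (sym (ℕP.*-identityʳ (suc q))))))

InR⇒DenCoprime : ∀ {m l} x → InR m l x → DenCoprime m x × DenCoprime l x
InR⇒DenCoprime (mkℚ a q c) (q⊥m , q⊥l) =
  denCoprime (suc q) a q⊥m (ℕ.s≤s ℕ.z≤n) (mkℚ-*-denominator a q c) ,
  denCoprime (suc q) a q⊥l (ℕ.s≤s ℕ.z≤n) (mkℚ-*-denominator a q c)

DenCoprime-- : ∀ {p x y} → DenCoprime p x → DenCoprime p y → DenCoprime p (x ℚ.- y)
DenCoprime-- {x = x} {y} (denCoprime q a q⊥p q>0 xq≡a) (denCoprime q' a' q'⊥p q'>0 yq'≡a') =
  denCoprime (q ℕ.* q') (a ℤ.* + q' ℤ.- a' ℤ.* + q) (coprime-*ˡ q⊥p q'⊥p) (ℕP.*-mono-< q>0 q'>0)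
  (begin
    (x ℚ.- y) ℚ.* ι (+ (q ℕ.* q'))
      ≡⟨ cong ((x ℚ.- y) ℚ.*_) (ι-ℕ* q q') ⟩
    (x ℚ.- y) ℚ.* (ι (+ q) ℚ.* ι (+ q'))
      ≡⟨ expand x y (ι (+ q)) (ι (+ q')) ⟩
    x ℚ.* ι (+ q) ℚ.* ι (+ q') ℚ.- y ℚ.* ι (+ q') ℚ.* ι (+ q)
      ≡⟨ cong₂ (λ u w → u ℚ.* ι (+ q') ℚ.- w ℚ.* ι (+ q)) xq≡a yq'≡a' ⟩
    ι a ℚ.* ι (+ q') ℚ.- ι a' ℚ.* ι (+ q)
      ≡⟨ sym (trans (ι-- (a ℤ.* + q') (a' ℤ.* + q)) (cong₂ ℚ._-_ (ι-* a (+ q')) (ι-* a' (+ q)))) ⟩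
    ι (a ℤ.* + q' ℤ.- a' ℤ.* + q) ∎)
  where
  open ≡-Reasoning
  expand : ∀ x y Q Q' → (x ℚ.- y) ℚ.* (Q ℚ.* Q') ≡ x ℚ.* Q ℚ.* Q' ℚ.- y ℚ.* Q' ℚ.* Q
  expand = solve 4 (λ x y Q Q' → (x :- y) :* (Q :* Q') := x :* Q :* Q' :- y :* Q' :* Q) refl

DenCoprime-ι* : ∀ {p x} z → DenCoprime p x → DenCoprime p (ι z ℚ.* x)
DenCoprime-ι* {x = x} z (denCoprime q a q⊥p q>0 xq≡a) = denCoprime q (z ℤ.* a) q⊥p q>0
  (begin
    ι z ℚ.* x ℚ.* ι (+ q)   ≡⟨ ℚP.*-assoc (ι z) x _ ⟩
    ι z ℚ.* (x ℚ.* ι (+ q)) ≡⟨ cong (ι z ℚ.*_) xq≡a ⟩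
    ι z ℚ.* ι a             ≡⟨ sym (ι-* z a) ⟩
    ι (z ℤ.* a)             ∎)
  where open ≡-Reasoning

-- If y has a denominator coprime to p and y·p^f is an integer t, then y is an integer z
-- (and t = p^f z): the denominator q of y divides t·q = a·p^f, hence divides a.
denCoprime-integral : ∀ p f {y t} → DenCoprime p y → y ℚ.* ι (+ (p ^ f)) ≡ ι t →
                      Σ ℤ λ z → y ≡ ι z × t ≡ + (p ^ f) ℤ.* z
denCoprime-integral p f {y} {t} (denCoprime (suc q') a q⊥p _ yq≡a) yP≡t = z , y≡z , t≡Pz
  where
  q : ℕ
  q = suc q'
  P : ℕ
  P = p ^ f
  tq≡aP : t ℤ.* + q ≡ a ℤ.* + P
  tq≡aP = ι-injective (begin
    ι (t ℤ.* + q)                 ≡⟨ ι-* t (+ q) ⟩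
    ι t ℚ.* ι (+ q)               ≡⟨ cong (ℚ._* ι (+ q)) (sym yP≡t) ⟩
    y ℚ.* ι (+ P) ℚ.* ι (+ q)     ≡⟨ swap y (ι (+ P)) (ι (+ q)) ⟩
    y ℚ.* ι (+ q) ℚ.* ι (+ P)     ≡⟨ cong (ℚ._* ι (+ P)) yq≡a ⟩
    ι a ℚ.* ι (+ P)               ≡⟨ sym (ι-* a (+ P)) ⟩
    ι (a ℤ.* + P)                 ∎)
    where
    open ≡-Reasoning
    swap : ∀ y P q → y ℚ.* P ℚ.* q ≡ y ℚ.* q ℚ.* P
    swap = solve 3 (λ y P q → y :* P :* q := y :* q :* P) refl
  q∣a : q ℕD.∣ ℤ.∣ a ∣
  q∣a = Coprimality.coprime-divisor (coprime-^ q⊥p f) (ℕD.divides ℤ.∣ t ∣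
    (trans (ℕP.*-comm P _) (trans (sym (ℤP.abs-* a (+ P))) (trans (cong ℤ.∣_∣ (sym tq≡aP)) (ℤP.abs-* t (+ q))))))
  q∣ₛa : (+ q) ℤDS.∣ a
  q∣ₛa = ℤDS.∣ᵤ⇒∣ q∣a
  z : ℤ
  z = ℤDS._∣_.quotient q∣ₛa
  a≡zq : a ≡ z ℤ.* + q
  a≡zq = ℤDS._∣_.equality q∣ₛa
  y≡z : y ≡ ι z
  y≡z = *-cancelʳ-ι {q} (ℕ.s≤s ℕ.z≤n) (trans yq≡a (trans (cong ι a≡zq) (ι-* z (+ q))))
  t≡Pz : t ≡ + P ℤ.* z
  t≡Pz = ℤP.*-cancelʳ-≡ t (+ P ℤ.* z) (+ q)
    (trans tq≡aP (trans (cong (ℤ._* + P) a≡zq) (rotate z (+ q) (+ P))))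
    where
    rotate : ∀ z q P → z ℤ.* q ℤ.* P ≡ P ℤ.* z ℤ.* q
    rotate z q P = solveℤ (z ∷ q ∷ P ∷ [])

nonneg-quotient : ∀ P {a b} z → a ℕ.< P → + P ℤ.* z ℤ.+ + a ≡ + b →
                  Σ ℕ λ w → z ≡ + w × P ℕ.* w ℕ.+ a ≡ b
nonneg-quotient P {a} (+ w) _ eq =
  w , refl , ℤP.+-injective (trans (ℤP.pos-+ (P ℕ.* w) a) (trans (cong (ℤ._+ + a) (ℤP.pos-* P w)) eq))
nonneg-quotient P {a} {b} -[1+ w ] a<P eq = ⊥-elim (ℕP.<⇒≱ a<P (begin
  P                    ≤⟨ ℕP.m≤m*n P (suc w) ⟩
  P ℕ.* suc w          ≤⟨ ℕP.m≤n+m _ b ⟩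
  b ℕ.+ P ℕ.* suc w    ≡⟨ sym a≡b+Pw ⟩
  a                    ∎))
  where
  open ℕP.≤-Reasoning
  regroup : ∀ A P W → A ≡ (P ℤ.* ℤ.- W ℤ.+ A) ℤ.+ P ℤ.* W
  regroup A P W = solveℤ (A ∷ P ∷ W ∷ [])
  a≡b+Pw : a ≡ b ℕ.+ P ℕ.* suc w
  a≡b+Pw = ℤP.+-injective (trans (regroup (+ a) (+ P) (+ suc w))
    (trans (cong (ℤ._+ + P ℤ.* + suc w) eq)
      (sym (trans (ℤP.pos-+ b (P ℕ.* suc w)) (cong (λ x → + b ℤ.+ x) (ℤP.pos-* P (suc w)))))))

digit-unique : ∀ p f {x k k' d d'} → DenCoprime p k → DenCoprime p k' →
               d ℕ.< p ^ f → d' ℕ.< p ^ f →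
               ι (+ (p ^ f)) ℚ.* k ℚ.+ ι (+ d) ≡ x → ι (+ (p ^ f)) ℚ.* k' ℚ.+ ι (+ d') ≡ x →
               k ≡ k' × d ≡ d'
digit-unique p f {x} {k} {k'} {d} {d'} k∈D k'∈D d<P d'<P eq eq' =
  conclude (denCoprime-integral p f (DenCoprime-- k∈D k'∈D) difference)
  where
  P : ℚ
  P = ι (+ (p ^ f))
  difference : (k ℚ.- k') ℚ.* P ≡ ι (+ d' ℤ.- + d)
  difference = begin
    (k ℚ.- k') ℚ.* P
      ≡⟨ rearrange k k' P (ι (+ d)) (ι (+ d')) ⟩
    (P ℚ.* k ℚ.+ ι (+ d)) ℚ.- (P ℚ.* k' ℚ.+ ι (+ d')) ℚ.+ (ι (+ d') ℚ.- ι (+ d))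
      ≡⟨ cong₂ (λ u w → u ℚ.- w ℚ.+ (ι (+ d') ℚ.- ι (+ d))) eq eq' ⟩
    x ℚ.- x ℚ.+ (ι (+ d') ℚ.- ι (+ d))
      ≡⟨ cancel x (ι (+ d') ℚ.- ι (+ d)) ⟩
    ι (+ d') ℚ.- ι (+ d)
      ≡⟨ sym (ι-- (+ d') (+ d)) ⟩
    ι (+ d' ℤ.- + d) ∎
    where
    open ≡-Reasoning
    rearrange : ∀ k k' P d d' → (k ℚ.- k') ℚ.* P ≡ (P ℚ.* k ℚ.+ d) ℚ.- (P ℚ.* k' ℚ.+ d') ℚ.+ (d' ℚ.- d)
    rearrange = solve 5 (λ k k' P d d' → (k :- k') :* P := (P :* k :+ d) :- (P :* k' :+ d') :+ (d' :- d)) refl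
    cancel : ∀ x w → x ℚ.- x ℚ.+ w ≡ w
    cancel = solve 2 (λ x w → x :- x :+ w := w) refl
  sub-add : ∀ a b → a ℤ.- b ℤ.+ b ≡ a
  sub-add a b = solveℤ (a ∷ b ∷ [])
  -- k - k' = z with p^f z = d' - d; since 0 ≤ d, d' < p^f this forces z = 0.
  conclude : Σ ℤ (λ z → k ℚ.- k' ≡ ι z × + d' ℤ.- + d ≡ + (p ^ f) ℤ.* z) → k ≡ k' × d ≡ d'
  conclude (z , k-k'≡z , d'-d≡Pz)
    with nonneg-quotient (p ^ f) z d<P (trans (sym (cong (ℤ._+ + d) d'-d≡Pz)) (sub-add (+ d') (+ d)))
  ... | zero , refl , P0+d≡d' =
    k≡k' , trans (sym (ℕP.+-identityˡ d)) (trans (cong (ℕ._+ d) (sym (ℕP.*-zeroʳ (p ^ f)))) P0+d≡d')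
    where
    -- ι (+ 0) is 0ℚ by definition.
    k-k'≡0 : k ℚ.- k' ≡ ℚ.0ℚ
    k-k'≡0 = k-k'≡z
    k≡k' : k ≡ k'
    k≡k' = trans (solve 2 (λ k k' → k := (k :- k') :+ k') refl k k')
             (trans (cong (ℚ._+ k') k-k'≡0) (ℚP.+-identityˡ k'))
  ... | suc w , refl , Pw+d≡d' = ⊥-elim (ℕP.<⇒≱ d'<P (begin
    p ^ f                   ≤⟨ ℕP.m≤m*n (p ^ f) (suc w) ⟩
    p ^ f ℕ.* suc w         ≤⟨ ℕP.m≤m+n _ d ⟩
    p ^ f ℕ.* suc w ℕ.+ d   ≡⟨ Pw+d≡d' ⟩
    d'                      ∎))
    where open ℕP.≤-Reasoning

-- For A ≥ 0 this is M·r ≤ L·s < L·M.  For A < 0 we have M·r = L·s + |A|: r = L would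
-- give l ∣ |A|, and r > L would give |A| ≥ M(L+1) - L(M-1) = M + L.
remainder-bound : ∀ (l L M s r : ℕ) (A : ℤ) → l ℕD.∣ L → 0 ℕ.< L → s ℕ.< M →
                  + (L ℕ.* s) ≡ + (M ℕ.* r) ℤ.+ A → ¬ (l ℕD.∣ ℤ.∣ A ∣) → ℤ.∣ A ∣ ℕ.< M ℕ.⊔ L →
                  r ℕ.< L
remainder-bound l L M s r A l∣L L>0 s<M Ls≡Mr+A l∤A A<M⊔L with r ℕ.<? L
... | yes r<L = r<L
... | no r≮L with A
...   | + x = ⊥-elim (ℕP.<⇒≱ (ℕP.*-monoʳ-< L {{ℕ.>-nonZero L>0}} s<M) (begin
          L ℕ.* M        ≡⟨ ℕP.*-comm L M ⟩
          M ℕ.* L        ≤⟨ ℕP.*-monoʳ-≤ M (ℕP.≮⇒≥ r≮L) ⟩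
          M ℕ.* r        ≤⟨ ℕP.m≤m+n _ x ⟩
          M ℕ.* r ℕ.+ x  ≡⟨ ℤP.+-injective (trans (ℤP.pos-+ (M ℕ.* r) x) (sym Ls≡Mr+A)) ⟩
          L ℕ.* s        ∎))
  where open ℕP.≤-Reasoning
...   | -[1+ x ] = ⊥-elim (r≤L-impossible (ℕP.m≤n⇒m<n∨m≡n (ℕP.≮⇒≥ r≮L)))
  where
  X : ℕ
  X = suc x
  Mr≡Ls+X : M ℕ.* r ≡ L ℕ.* s ℕ.+ X
  Mr≡Ls+X = ℤP.+-injective (begin
    + (M ℕ.* r)                        ≡⟨ add-sub (+ (M ℕ.* r)) (+ X) ⟩
    + (M ℕ.* r) ℤ.+ -[1+ x ] ℤ.+ + X   ≡⟨ cong (ℤ._+ + X) (sym Ls≡Mr+A) ⟩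
    + (L ℕ.* s) ℤ.+ + X                ≡⟨ sym (ℤP.pos-+ (L ℕ.* s) X) ⟩
    + (L ℕ.* s ℕ.+ X)                  ∎)
    where
    open ≡-Reasoning
    add-sub : ∀ a b → a ≡ a ℤ.+ ℤ.- b ℤ.+ b
    add-sub a b = solveℤ (a ∷ b ∷ [])
  r≤L-impossible : (L ℕ.< r) ⊎ (L ≡ r) → ⊥
  r≤L-impossible (inj₂ refl) =
    l∤A (ℕD.∣m+n∣m⇒∣n (subst (l ℕD.∣_) Mr≡Ls+X (ℕD.∣n⇒∣m*n M l∣L)) (ℕD.∣m⇒∣m*n s l∣L))
  r≤L-impossible (inj₁ L<r) = ℕP.<⇒≱ A<M⊔L (ℕP.≤-trans (ℕP.m⊔n≤m+n M L)
    (ℕP.+-cancelʳ-≤ (L ℕ.* s) _ _ (begin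
      M ℕ.+ L ℕ.+ L ℕ.* s    ≡⟨ solveℕ (M ∷ L ∷ s ∷ []) ⟩
      M ℕ.+ L ℕ.* suc s      ≤⟨ ℕP.+-monoʳ-≤ M (ℕP.*-monoʳ-≤ L s<M) ⟩
      M ℕ.+ L ℕ.* M          ≡⟨ solveℕ (M ∷ L ∷ []) ⟩
      M ℕ.* suc L            ≤⟨ ℕP.*-monoʳ-≤ M L<r ⟩
      M ℕ.* r                ≡⟨ Mr≡Ls+X ⟩
      L ℕ.* s ℕ.+ X          ≡⟨ ℕP.+-comm (L ℕ.* s) X ⟩
      X ℕ.+ L ℕ.* s          ∎)))
    where open ℕP.≤-Reasoning

+-shift-1 : ∀ v x → v ℤ.+ x ℤ.+ + 1 ≡ v ℤ.+ (+ 1 ℤ.+ x)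
+-shift-1 v x = solveℤ (v ∷ x ∷ [])

+-shift-back : ∀ v x → v ℤ.+ (+ 1 ℤ.+ x) ℤ.- + 1 ℤ.- x ≡ v
+-shift-back v x = solveℤ (v ∷ x ∷ [])

sumF-unfoldˡ : ∀ (e : ℤ → ℕ) x u → sumF e x (suc u) ≡ e x ℕ.+ sumF e (x ℤ.+ + 1) u
sumF-unfoldˡ e x zero = trans (cong e (ℤP.+-identityʳ x)) (sym (ℕP.+-identityʳ (e x)))
sumF-unfoldˡ e x (suc u) = begin
  sumF e x (suc u) ℕ.+ e (x ℤ.+ + suc u)
    ≡⟨ cong (ℕ._+ e (x ℤ.+ + suc u)) (sumF-unfoldˡ e x u) ⟩
  e x ℕ.+ sumF e (x ℤ.+ + 1) u ℕ.+ e (x ℤ.+ + suc u)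
    ≡⟨ ℕP.+-assoc (e x) _ _ ⟩
  e x ℕ.+ (sumF e (x ℤ.+ + 1) u ℕ.+ e (x ℤ.+ + suc u))
    ≡⟨ cong (λ z → e x ℕ.+ (sumF e (x ℤ.+ + 1) u ℕ.+ e z)) (sym (ℤP.+-assoc x (+ 1) (+ u))) ⟩
  e x ℕ.+ (sumF e (x ℤ.+ + 1) u ℕ.+ e ((x ℤ.+ + 1) ℤ.+ + u)) ∎
  where open ≡-Reasoning

sumFbar-unfoldˡ : ∀ (e : ℤ → ℕ) w u → sumFbar e (w ℤ.+ + 1) (suc u) ≡ e w ℕ.+ sumFbar e w u
sumFbar-unfoldˡ e w zero = trans (cong e (back w)) (sym (ℕP.+-identityʳ (e w)))
  where
  back : ∀ w → w ℤ.+ + 1 ℤ.- + 1 ℤ.- + 0 ≡ w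
  back w = solveℤ (w ∷ [])
sumFbar-unfoldˡ e w (suc u) = begin
  sumFbar e (w ℤ.+ + 1) (suc u) ℕ.+ e (w ℤ.+ + 1 ℤ.- + 1 ℤ.- + suc u)
    ≡⟨ cong₂ ℕ._+_ (sumFbar-unfoldˡ e w u) (cong e (back w (+ u))) ⟩
  e w ℕ.+ sumFbar e w u ℕ.+ e (w ℤ.- + 1 ℤ.- + u)
    ≡⟨ ℕP.+-assoc (e w) _ _ ⟩
  e w ℕ.+ (sumFbar e w u ℕ.+ e (w ℤ.- + 1 ℤ.- + u)) ∎
  where
  open ≡-Reasoning
  back : ∀ w x → w ℤ.+ + 1 ℤ.- + 1 ℤ.- (+ 1 ℤ.+ x) ≡ w ℤ.- + 1 ℤ.- x
  back w x = solveℤ (w ∷ x ∷ [])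

sumFbar≡sumF : ∀ (e : ℤ → ℕ) u x → sumFbar e (x ℤ.+ + u) u ≡ sumF e x u
sumFbar≡sumF e zero x = refl
sumFbar≡sumF e (suc u) x = begin
  sumFbar e (x ℤ.+ + suc u) (suc u)        ≡⟨ cong (λ z → sumFbar e z (suc u)) (sym (+-shift-1 x (+ u))) ⟩
  sumFbar e (x ℤ.+ + u ℤ.+ + 1) (suc u)    ≡⟨ sumFbar-unfoldˡ e (x ℤ.+ + u) u ⟩
  e (x ℤ.+ + u) ℕ.+ sumFbar e (x ℤ.+ + u) u ≡⟨ cong (e (x ℤ.+ + u) ℕ.+_) (sumFbar≡sumF e u x) ⟩
  e (x ℤ.+ + u) ℕ.+ sumF e x u             ≡⟨ ℕP.+-comm _ (sumF e x u) ⟩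
  sumF e x (suc u)                         ∎
  where open ≡-Reasoning

-- The module assumes only the parts of the setting the expansions depend on; the
-- admissibility conditions enter through the digit bounds s_v < m^{f_v}, r_v < l^{e_v}.
module Expansions
  (m l : ℕ) (m>0 : 0 ℕ.< m) (f e s r : ℤ → ℕ)
  (s<m^f : ∀ v → s v ℕ.< m ^ f v) (r<l^e : ∀ v → r v ℕ.< l ^ e v)
  (n : ℤ → ℚ) (n∈R : ∀ v → InR m l (n v))
  (n≡s : ∀ v → CongR m l (m ^ f v) (n v) (ℕ→ℚ (s v)))
  (n-step : ∀ v → n (v ℤ.+ + 1) ≡
     ℕ→ℚ (l ^ e v) ℚ.* ((n v ℚ.- ℕ→ℚ (s v)) divℕ (m ^ f v)) ℚ.+ ℕ→ℚ (r v))
  (k : ℤ → ℕ → ℚ) (d : ℤ → ℕ → ℕ) (k₀ : ∀ v → k v 0 ≡ n v)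
  (k-step : ∀ v u → k v u ≡ ℕ→ℚ (m ^ f (v ℤ.+ + u)) ℚ.* k v (suc u) ℚ.+ ℕ→ℚ (d v u)
     × d v u ℕ.< m ^ f (v ℤ.+ + u) × InR m l (k v (suc u)))
  (j : ℤ → ℕ → ℚ) (b : ℤ → ℕ → ℕ) (j₀ : ∀ v → j v 0 ≡ n v)
  (j-step : ∀ v u → j v u ≡ ℕ→ℚ (l ^ e (v ℤ.- + 1 ℤ.- + u)) ℚ.* j v (suc u) ℚ.+ ℕ→ℚ (b v u)
     × b v u ℕ.< l ^ e (v ℤ.- + 1 ℤ.- + u) × InR m l (j v (suc u)))
  where

  Q : ℤ → ℕ → ℚ
  Q = Qadd m l f e s r d

  Φ : ℤ → ℚ
  Φ w = (n w ℚ.- ι (+ s w)) divℕ (m ^ f w)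

  lᵉ : ℤ → ℚ
  lᵉ v = ι (+ (l ^ e v))

  m^f>0 : ∀ w → 0 ℕ.< m ^ f w
  m^f>0 w = ℕP.m^n>0 m {{ℕ.>-nonZero m>0}} (f w)

  ι-l^-+ : ∀ x y → ι (+ (l ^ (x ℕ.+ y))) ≡ ι (+ (l ^ x)) ℚ.* ι (+ (l ^ y))
  ι-l^-+ x y = trans (cong (λ z → ι (+ z)) (ℕP.^-distribˡ-+-* l x y)) (ι-ℕ* (l ^ x) (l ^ y))

  k∈Dₘ : ∀ v u → DenCoprime m (k v u)
  k∈Dₘ v zero    = subst (DenCoprime m) (sym (k₀ v)) (proj₁ (InR⇒DenCoprime (n v) (n∈R v)))
  k∈Dₘ v (suc u) = proj₁ (InR⇒DenCoprime (k v (suc u)) (proj₂ (proj₂ (k-step v u))))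

  k∈Dₗ : ∀ v u → DenCoprime l (k v u)
  k∈Dₗ v zero    = subst (DenCoprime l) (sym (k₀ v)) (proj₂ (InR⇒DenCoprime (n v) (n∈R v)))
  k∈Dₗ v (suc u) = proj₂ (InR⇒DenCoprime (k v (suc u)) (proj₂ (proj₂ (k-step v u))))

  first-digit : ∀ v → k v 1 ≡ Φ v × d v 0 ≡ s v
  first-digit v =
    digit-unique m (f v) (k∈Dₘ v 1) (proj₁ (InR⇒DenCoprime (Φ v) (n≡s v)))
      (proj₂ k-step₀) (s<m^f v) (sym (proj₁ k-step₀)) Φ-digit
    where
    k-step₀ : n v ≡ ι (+ (m ^ f v)) ℚ.* k v 1 ℚ.+ ι (+ d v 0) × d v 0 ℕ.< m ^ f v
    k-step₀ = subst (λ w → n v ≡ ι (+ (m ^ f w)) ℚ.* k v 1 ℚ.+ ι (+ d v 0) × d v 0 ℕ.< m ^ f w)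
                (ℤP.+-identityʳ v) (trans (sym (k₀ v)) (proj₁ (k-step v 0)) , proj₁ (proj₂ (k-step v 0)))
    Φ-digit : ι (+ (m ^ f v)) ℚ.* Φ v ℚ.+ ι (+ s v) ≡ n v
    Φ-digit = begin
      ι (+ (m ^ f v)) ℚ.* Φ v ℚ.+ ι (+ s v)
        ≡⟨ cong (ℚ._+ ι (+ s v)) (trans (ℚP.*-comm _ (Φ v)) (divℕ-*-cancel (m^f>0 v) _)) ⟩
      n v ℚ.- ι (+ s v) ℚ.+ ι (+ s v)
        ≡⟨ solve 2 (λ x y → x :- y :+ y := x) refl (n v) (ι (+ s v)) ⟩
      n v ∎
      where open ≡-Reasoning

  Φ-expansion : ∀ v u → Φ (v ℤ.+ + u) ≡ ι (+ (l ^ sumF e v u)) ℚ.* k v (suc u) ℚ.+ Q v u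
  Φ-expansion v zero = begin
    Φ (v ℤ.+ + 0)            ≡⟨ cong Φ (ℤP.+-identityʳ v) ⟩
    Φ v                      ≡⟨ sym (proj₁ (first-digit v)) ⟩
    k v 1                    ≡⟨ sym (trans (ℚP.+-identityʳ _) (ℚP.*-identityˡ _)) ⟩
    ι (+ 1) ℚ.* k v 1 ℚ.+ ℚ.0ℚ ∎
    where open ≡-Reasoning
  Φ-expansion v (suc u) = divℕ-unique (m^f>0 w') (begin
    n w' ℚ.- S
      ≡⟨ cong (ℚ._- S) (trans (cong n (sym (+-shift-1 v (+ u)))) (n-step w)) ⟩
    Lw ℚ.* Φ w ℚ.+ R ℚ.- S
      ≡⟨ cong (λ z → Lw ℚ.* z ℚ.+ R ℚ.- S) (Φ-expansion v u) ⟩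
    Lw ℚ.* (A ℚ.* k₁ ℚ.+ Q v u) ℚ.+ R ℚ.- S
      ≡⟨ cong (λ z → Lw ℚ.* (A ℚ.* z ℚ.+ Q v u) ℚ.+ R ℚ.- S) (proj₁ (k-step v (suc u))) ⟩
    Lw ℚ.* (A ℚ.* (P ℚ.* k₂ ℚ.+ D) ℚ.+ Q v u) ℚ.+ R ℚ.- S
      ≡⟨ regroup Lw A P k₂ D (Q v u) R S ⟩
    A ℚ.* Lw ℚ.* k₂ ℚ.* P ℚ.+ (A ℚ.* Lw ℚ.* D ℚ.+ Lw ℚ.* Q v u ℚ.- S ℚ.+ R)
        ≡⟨ cong₂ (λ x y → x ℚ.* k₂ ℚ.* P ℚ.+ (y ℚ.+ Lw ℚ.* Q v u ℚ.- S ℚ.+ R)) (sym A·Lw)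
                 (sym (trans (ι-ℕ* (l ^ sumF e v (suc u)) (d v (suc u))) (cong (ℚ._* D) A·Lw))) ⟩
    E ℚ.* k₂ ℚ.* P ℚ.+ numerator
      ≡⟨ cong (E ℚ.* k₂ ℚ.* P ℚ.+_) (sym (divℕ-*-cancel (m^f>0 w') numerator)) ⟩
    E ℚ.* k₂ ℚ.* P ℚ.+ Q v (suc u) ℚ.* P
      ≡⟨ sym (ℚP.*-distribʳ-+ P (E ℚ.* k₂) (Q v (suc u))) ⟩
    (E ℚ.* k₂ ℚ.+ Q v (suc u)) ℚ.* P ∎)
    where
    open ≡-Reasoning
    w : ℤ
    w = v ℤ.+ + u
    w' : ℤ
    w' = v ℤ.+ + suc u
    P : ℚ
    P = ι (+ (m ^ f w'))
    A : ℚ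
    A = ι (+ (l ^ sumF e v u))
    E : ℚ
    E = ι (+ (l ^ sumF e v (suc u)))
    Lw : ℚ
    Lw = lᵉ w
    k₁ : ℚ
    k₁ = k v (suc u)
    k₂ : ℚ
    k₂ = k v (suc (suc u))
    D : ℚ
    D = ι (+ d v (suc u))
    R : ℚ
    R = ι (+ r w)
    S : ℚ
    S = ι (+ s w')
    numerator : ℚ
    numerator = ι (+ (l ^ sumF e v (suc u) ℕ.* d v (suc u))) ℚ.+ Lw ℚ.* Q v u ℚ.- S ℚ.+ R
    A·Lw : E ≡ A ℚ.* Lw
    A·Lw = ι-l^-+ (sumF e v u) (e w)
    regroup : ∀ Lw A P k₂ D Q R S → Lw ℚ.* (A ℚ.* (P ℚ.* k₂ ℚ.+ D) ℚ.+ Q) ℚ.+ R ℚ.- S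
              ≡ A ℚ.* Lw ℚ.* k₂ ℚ.* P ℚ.+ (A ℚ.* Lw ℚ.* D ℚ.+ Lw ℚ.* Q ℚ.- S ℚ.+ R)
    regroup = solve 8 (λ Lw A P k₂ D Q R S → Lw :* (A :* (P :* k₂ :+ D) :+ Q) :+ R :- S
                        := A :* Lw :* k₂ :* P :+ (A :* Lw :* D :+ Lw :* Q :- S :+ R)) refl

  carry : ℤ → ℕ → ℚ
  carry v u = k (v ℤ.+ + 1) u ℚ.- lᵉ v ℚ.* k v (suc u)

  carry∈Dₘ : ∀ v u → DenCoprime m (carry v u)
  carry∈Dₘ v u = DenCoprime-- (k∈Dₘ (v ℤ.+ + 1) u) (DenCoprime-ι* (+ (l ^ e v)) (k∈Dₘ v (suc u)))

  k-step₊₁ : ∀ v u →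
    k (v ℤ.+ + 1) u ≡ ι (+ (m ^ f (v ℤ.+ + suc u))) ℚ.* k (v ℤ.+ + 1) (suc u) ℚ.+ ι (+ d (v ℤ.+ + 1) u)
    × d (v ℤ.+ + 1) u ℕ.< m ^ f (v ℤ.+ + suc u)
  k-step₊₁ v u =
    subst (λ z → k (v ℤ.+ + 1) u ≡ ι (+ (m ^ f z)) ℚ.* k (v ℤ.+ + 1) (suc u) ℚ.+ ι (+ d (v ℤ.+ + 1) u)
                 × d (v ℤ.+ + 1) u ℕ.< m ^ f z)
      (ℤP.+-assoc v (+ 1) (+ u)) (proj₁ (k-step (v ℤ.+ + 1) u) , proj₁ (proj₂ (k-step (v ℤ.+ + 1) u)))

  -- c_{v,0} = r_v, since n_{v+1} = l^{e_v} k_{v,1} + r_v.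
  carry-zero : ∀ v → carry v 0 ≡ ι (+ r v)
  carry-zero v = begin
    k (v ℤ.+ + 1) 0 ℚ.- lᵉ v ℚ.* k v 1
      ≡⟨ cong₂ (λ x y → x ℚ.- lᵉ v ℚ.* y) (trans (k₀ (v ℤ.+ + 1)) (n-step v)) (proj₁ (first-digit v)) ⟩
    lᵉ v ℚ.* Φ v ℚ.+ ι (+ r v) ℚ.- lᵉ v ℚ.* Φ v
      ≡⟨ solve 2 (λ x y → x :+ y :- x := y) refl (lᵉ v ℚ.* Φ v) (ι (+ r v)) ⟩
    ι (+ r v) ∎
    where open ≡-Reasoning

  carry-step : ∀ v u → carry v (suc u) ℚ.* ι (+ (m ^ f (v ℤ.+ + suc u)))
                       ≡ carry v u ℚ.- ι (+ d (v ℤ.+ + 1) u) ℚ.+ ι (+ (l ^ e v ℕ.* d v (suc u)))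
  carry-step v u = begin
    (k₁' ℚ.- L ℚ.* k₂) ℚ.* P
      ≡⟨ regroup k₁' k₂ L P d' dd ⟩
    (P ℚ.* k₁' ℚ.+ d') ℚ.- L ℚ.* (P ℚ.* k₂ ℚ.+ dd) ℚ.- d' ℚ.+ L ℚ.* dd
      ≡⟨ cong₂ (λ x y → x ℚ.- L ℚ.* y ℚ.- d' ℚ.+ L ℚ.* dd)
               (sym (proj₁ (k-step₊₁ v u))) (sym (proj₁ (k-step v (suc u)))) ⟩
    carry v u ℚ.- d' ℚ.+ L ℚ.* dd
      ≡⟨ cong (carry v u ℚ.- d' ℚ.+_) (sym (ι-ℕ* (l ^ e v) (d v (suc u)))) ⟩
    carry v u ℚ.- d' ℚ.+ ι (+ (l ^ e v ℕ.* d v (suc u))) ∎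
    where
    open ≡-Reasoning
    k₁' : ℚ
    k₁' = k (v ℤ.+ + 1) (suc u)
    k₂ : ℚ
    k₂ = k v (suc (suc u))
    L : ℚ
    L = lᵉ v
    P : ℚ
    P = ι (+ (m ^ f (v ℤ.+ + suc u)))
    d' : ℚ
    d' = ι (+ d (v ℤ.+ + 1) u)
    dd : ℚ
    dd = ι (+ d v (suc u))
    regroup : ∀ k₁' k₂ L P d' dd → (k₁' ℚ.- L ℚ.* k₂) ℚ.* P
              ≡ (P ℚ.* k₁' ℚ.+ d') ℚ.- L ℚ.* (P ℚ.* k₂ ℚ.+ dd) ℚ.- d' ℚ.+ L ℚ.* dd
    regroup = solve 6 (λ k₁' k₂ L P d' dd → (k₁' :- L :* k₂) :* P
                        := (P :* k₁' :+ d') :- L :* (P :* k₂ :+ dd) :- d' :+ L :* dd) refl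

  -- A carry which is an l^{e_v}-adic digit t produces a next carry which is again one:
  -- m^{f} c' = t - d' + l^{e_v} d with 0 ≤ d, d' < m^f forces 0 ≤ c' < l^{e_v}.
  carry-digit-step : ∀ v u t → carry v u ≡ ι (+ t) → t ℕ.< l ^ e v →
                     Σ ℕ λ t' → carry v (suc u) ≡ ι (+ t') × t' ℕ.< l ^ e v
  carry-digit-step v u t c≡t t<L = bound (denCoprime-integral m (f w) (carry∈Dₘ v (suc u)) c'P≡integer)
    where
    w : ℤ
    w = v ℤ.+ + suc u
    P : ℕ
    P = m ^ f w
    L : ℕ
    L = l ^ e v
    d' : ℕ
    d' = d (v ℤ.+ + 1) u
    dd : ℕ
    dd = d v (suc u)
    integer : ℤ
    integer = + t ℤ.- + d' ℤ.+ + (L ℕ.* dd)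
    c'P≡integer : carry v (suc u) ℚ.* ι (+ P) ≡ ι integer
    c'P≡integer = trans (carry-step v u)
      (trans (cong (λ x → x ℚ.- ι (+ d') ℚ.+ ι (+ (L ℕ.* dd))) c≡t)
        (sym (trans (ι-+ (+ t ℤ.- + d') (+ (L ℕ.* dd))) (cong (ℚ._+ ι (+ (L ℕ.* dd))) (ι-- (+ t) (+ d'))))))
    regroup : ∀ a b c → (a ℤ.- b ℤ.+ c) ℤ.+ b ≡ a ℤ.+ c
    regroup a b c = solveℤ (a ∷ b ∷ c ∷ [])
    quotient-bound : ∀ t' → P ℕ.* t' ℕ.+ d' ≡ t ℕ.+ L ℕ.* dd → t' ℕ.< L
    quotient-bound t' Pt'+d'≡ = ℕP.*-cancelˡ-< P t' L (begin-strict
      P ℕ.* t'             ≤⟨ ℕP.m≤m+n (P ℕ.* t') d' ⟩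
      P ℕ.* t' ℕ.+ d'      ≡⟨ Pt'+d'≡ ⟩
      t ℕ.+ L ℕ.* dd       <⟨ ℕP.+-monoˡ-< (L ℕ.* dd) t<L ⟩
      L ℕ.+ L ℕ.* dd       ≡⟨ sym (ℕP.*-suc L dd) ⟩
      L ℕ.* suc dd         ≤⟨ ℕP.*-monoʳ-≤ L (proj₁ (proj₂ (k-step v (suc u)))) ⟩
      L ℕ.* P              ≡⟨ ℕP.*-comm L P ⟩
      P ℕ.* L              ∎)
      where open ℕP.≤-Reasoning
    bound : Σ ℤ (λ z → carry v (suc u) ≡ ι z × integer ≡ + P ℤ.* z) →
            Σ ℕ λ t' → carry v (suc u) ≡ ι (+ t') × t' ℕ.< L
    bound (z , c'≡z , integer≡Pz)
      with nonneg-quotient P z (proj₂ (k-step₊₁ v u))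
             (trans (cong (ℤ._+ + d') (sym integer≡Pz))
               (trans (regroup (+ t) (+ d') (+ (L ℕ.* dd))) (sym (ℤP.pos-+ t (L ℕ.* dd)))))
    ... | t' , refl , Pt'+d'≡ = t' , c'≡z , quotient-bound t' Pt'+d'≡

  carry-digit : ∀ v u → Σ ℕ λ t → carry v u ≡ ι (+ t) × t ℕ.< l ^ e v
  carry-digit v zero = r v , carry-zero v , r<l^e v
  carry-digit v (suc u) with carry-digit v u
  ... | t , c≡t , t<L = carry-digit-step v u t c≡t t<L

  j-step₊ : ∀ v u → j (v ℤ.+ + suc u) u ≡ lᵉ v ℚ.* j (v ℤ.+ + suc u) (suc u) ℚ.+ ι (+ b (v ℤ.+ + suc u) u)
                    × b (v ℤ.+ + suc u) u ℕ.< l ^ e v × InR m l (j (v ℤ.+ + suc u) (suc u))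
  j-step₊ v u = subst (λ z → j w u ≡ ι (+ (l ^ e z)) ℚ.* j w (suc u) ℚ.+ ι (+ b w u)
                             × b w u ℕ.< l ^ e z × InR m l (j w (suc u)))
                  (+-shift-back v (+ u)) (j-step w u)
    where
    w : ℤ
    w = v ℤ.+ + suc u

  -- If the l-adic quotient j_{v+u+1,u} is k_{v+1,u} = l^{e_v} k_{v,u+1} + c_{v,u}, then by
  -- uniqueness of l^{e_v}-adic digits the next l-adic quotient is k_{v,u+1} and the
  -- digit b_{v+u+1,u} is the carry c_{v,u}.
  l-adic-step : ∀ v u → j ((v ℤ.+ + 1) ℤ.+ + u) u ≡ k (v ℤ.+ + 1) u →
                j (v ℤ.+ + suc u) (suc u) ≡ k v (suc u) × ι (+ b (v ℤ.+ + suc u) u) ≡ carry v u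
  l-adic-step v u j≡k = from-digit (carry-digit v u)
    where
    j-digit : lᵉ v ℚ.* j (v ℤ.+ + suc u) (suc u) ℚ.+ ι (+ b (v ℤ.+ + suc u) u) ≡ k (v ℤ.+ + 1) u
    j-digit = trans (sym (proj₁ (j-step₊ v u))) (trans (cong (λ z → j z u) (sym (ℤP.+-assoc v (+ 1) (+ u)))) j≡k)
    j∈Dₗ : DenCoprime l (j (v ℤ.+ + suc u) (suc u))
    j∈Dₗ = proj₂ (InR⇒DenCoprime (j (v ℤ.+ + suc u) (suc u)) (proj₂ (proj₂ (j-step₊ v u))))
    from-digit : (Σ ℕ λ t → carry v u ≡ ι (+ t) × t ℕ.< l ^ e v) →
                 j (v ℤ.+ + suc u) (suc u) ≡ k v (suc u) × ι (+ b (v ℤ.+ + suc u) u) ≡ carry v u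
    from-digit (t , c≡t , t<L) = proj₁ unique , trans (cong (λ z → ι (+ z)) (proj₂ unique)) (sym c≡t)
      where
      k-digit : lᵉ v ℚ.* k v (suc u) ℚ.+ ι (+ t) ≡ k (v ℤ.+ + 1) u
      k-digit = trans (cong (lᵉ v ℚ.* k v (suc u) ℚ.+_) (sym c≡t))
                  (solve 2 (λ x y → y :+ (x :- y) := x) refl (k (v ℤ.+ + 1) u) (lᵉ v ℚ.* k v (suc u)))
      unique : j (v ℤ.+ + suc u) (suc u) ≡ k v (suc u) × b (v ℤ.+ + suc u) u ≡ t
      unique = digit-unique l (e v) j∈Dₗ (k∈Dₗ v (suc u)) (proj₁ (proj₂ (j-step₊ v u))) t<L j-digit k-digit

  j≡k : ∀ u v → j (v ℤ.+ + u) u ≡ k v u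
  j≡k zero    v = trans (cong (λ z → j z 0) (ℤP.+-identityʳ v)) (trans (j₀ v) (sym (k₀ v)))
  j≡k (suc u) v = proj₁ (l-adic-step v u (j≡k u (v ℤ.+ + 1)))

  b≡carry : ∀ v u → ι (+ b (v ℤ.+ + suc u) u) ≡ carry v u
  b≡carry v u = proj₂ (l-adic-step v u (j≡k u (v ℤ.+ + 1)))

  b≡carry₊₁ : ∀ v u → ι (+ b (v ℤ.+ + suc u ℤ.+ + 1) (suc u)) ≡ carry v (suc u)
  b≡carry₊₁ v u = trans (cong (λ z → ι (+ b z (suc u))) (+-shift-1 v (+ suc u))) (b≡carry v (suc u))

  -- Both Q's arise by
  -- expanding Φ_{v+u+1}, from v and from v+1; the difference of the expansions is
  -- l^{E_{v+1,u}} c_{v,u+1}.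
  Q-difference : ∀ v u → Q v (suc u) ℚ.- Q (v ℤ.+ + 1) u
                 ≡ ι (+ (l ^ sumFbar e (v ℤ.+ + suc u) u)) ℚ.* ι (+ b (v ℤ.+ + suc u ℤ.+ + 1) (suc u))
  Q-difference v u = begin
    Q v (suc u) ℚ.- Q (v ℤ.+ + 1) u
      ≡⟨ subtract-expansions {lᵉ v} {B} {k (v ℤ.+ + 1) (suc u)} {k v (suc (suc u))} (trans (sym from-v) from-v+1) ⟩
    B ℚ.* carry v (suc u)
      ≡⟨ cong₂ ℚ._*_ (sym Ē≡E) (sym (b≡carry₊₁ v u)) ⟩
    ι (+ (l ^ sumFbar e (v ℤ.+ + suc u) u)) ℚ.* ι (+ b (v ℤ.+ + suc u ℤ.+ + 1) (suc u)) ∎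
    where
    open ≡-Reasoning
    B : ℚ
    B = ι (+ (l ^ sumF e (v ℤ.+ + 1) u))
    Ē≡E : ι (+ (l ^ sumFbar e (v ℤ.+ + suc u) u)) ≡ B
    Ē≡E = cong (λ z → ι (+ (l ^ z)))
      (trans (cong (λ z → sumFbar e z u) (sym (ℤP.+-assoc v (+ 1) (+ u)))) (sumFbar≡sumF e u (v ℤ.+ + 1)))
    from-v : Φ (v ℤ.+ + suc u) ≡ (lᵉ v ℚ.* B) ℚ.* k v (suc (suc u)) ℚ.+ Q v (suc u)
    from-v = trans (Φ-expansion v (suc u)) (cong (λ z → z ℚ.* k v (suc (suc u)) ℚ.+ Q v (suc u))
      (trans (cong (λ z → ι (+ (l ^ z))) (sumF-unfoldˡ e v u)) (ι-l^-+ (e v) (sumF e (v ℤ.+ + 1) u))))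
    from-v+1 : Φ (v ℤ.+ + suc u) ≡ B ℚ.* k (v ℤ.+ + 1) (suc u) ℚ.+ Q (v ℤ.+ + 1) u
    from-v+1 = trans (cong Φ (sym (ℤP.+-assoc v (+ 1) (+ u)))) (Φ-expansion (v ℤ.+ + 1) u)
    subtract-expansions : ∀ {L B k₁ k₂ Q₁ Q₂} → (L ℚ.* B) ℚ.* k₂ ℚ.+ Q₁ ≡ B ℚ.* k₁ ℚ.+ Q₂ →
                          Q₁ ℚ.- Q₂ ≡ B ℚ.* (k₁ ℚ.- L ℚ.* k₂)
    subtract-expansions {L} {B} {k₁} {k₂} {Q₁} {Q₂} eq = begin
      Q₁ ℚ.- Q₂
        ≡⟨ regroup L B k₁ k₂ Q₁ Q₂ ⟩
      (L ℚ.* B) ℚ.* k₂ ℚ.+ Q₁ ℚ.- (B ℚ.* k₁ ℚ.+ Q₂) ℚ.+ B ℚ.* (k₁ ℚ.- L ℚ.* k₂)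
        ≡⟨ cong (λ z → z ℚ.- (B ℚ.* k₁ ℚ.+ Q₂) ℚ.+ B ℚ.* (k₁ ℚ.- L ℚ.* k₂)) eq ⟩
      B ℚ.* k₁ ℚ.+ Q₂ ℚ.- (B ℚ.* k₁ ℚ.+ Q₂) ℚ.+ B ℚ.* (k₁ ℚ.- L ℚ.* k₂)
        ≡⟨ solve 2 (λ x y → x :- x :+ y := y) refl (B ℚ.* k₁ ℚ.+ Q₂) _ ⟩
      B ℚ.* (k₁ ℚ.- L ℚ.* k₂) ∎
      where
      regroup : ∀ L B k₁ k₂ Q₁ Q₂ →
                Q₁ ℚ.- Q₂ ≡ (L ℚ.* B) ℚ.* k₂ ℚ.+ Q₁ ℚ.- (B ℚ.* k₁ ℚ.+ Q₂) ℚ.+ B ℚ.* (k₁ ℚ.- L ℚ.* k₂)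
      regroup = solve 6 (λ L B k₁ k₂ Q₁ Q₂ →
                  Q₁ :- Q₂ := (L :* B) :* k₂ :+ Q₁ :- (B :* k₁ :+ Q₂) :+ B :* (k₁ :- L :* k₂)) refl

  -- Second claim: m^{f_{v+u+1}} b_{v+u+2,u+1} = l^{e_v} d_{v,u+1} - d_{v+1,u} + b_{v+u+1,u},
  -- which is the carry recursion with the carries replaced by l-adic digits.
  b-recursion : ∀ v u → ι (+ b (v ℤ.+ + suc u ℤ.+ + 1) (suc u))
                ≡ (ι (+ (l ^ e v ℕ.* d v (suc u))) ℚ.- ι (+ d (v ℤ.+ + 1) u) ℚ.+ ι (+ b (v ℤ.+ + suc u) u))
                    divℕ (m ^ f (v ℤ.+ + suc u))
  b-recursion v u = sym (divℕ-unique (m^f>0 (v ℤ.+ + suc u)) (begin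
    LD ℚ.- d' ℚ.+ ι (+ b (v ℤ.+ + suc u) u)
      ≡⟨ cong (λ z → LD ℚ.- d' ℚ.+ z) (b≡carry v u) ⟩
    LD ℚ.- d' ℚ.+ carry v u
      ≡⟨ solve 3 (λ x y z → x :- y :+ z := z :- y :+ x) refl LD d' (carry v u) ⟩
    carry v u ℚ.- d' ℚ.+ LD
      ≡⟨ sym (carry-step v u) ⟩
    carry v (suc u) ℚ.* P
      ≡⟨ cong (ℚ._* P) (sym (b≡carry₊₁ v u)) ⟩
    ι (+ b (v ℤ.+ + suc u ℤ.+ + 1) (suc u)) ℚ.* P ∎))
    where
    open ≡-Reasoning
    LD : ℚ
    LD = ι (+ (l ^ e v ℕ.* d v (suc u)))
    d' : ℚ
    d' = ι (+ d (v ℤ.+ + 1) u)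
    P : ℚ
    P = ι (+ (m ^ f (v ℤ.+ + suc u)))

theorem4p1 :
  (m l τ : ℕ) → 2 ℕ.≤ m → 2 ℕ.≤ l → Coprime m l → 1 ℕ.≤ τ →
  (f : ℤ → ℕ) → (∀ v → f (v ℤ.+ + τ) ≡ f v) → (∀ v → 1 ℕ.≤ f v) →
  (a : ℤ → ℕ → ℤ) → (∀ v i → a (v ℤ.+ + τ) i ≡ a v i) → (∀ v → a v 0 ≡ + 0) →
  (∀ v i → 1 ℕ.≤ i → i ℕ.< l →
    ((+ l) ℤD.∣ (a v i ℤ.+ + (m ^ f v ℕ.* i))) × ¬ ((+ m) ℤD.∣ a v i) × ¬ ((+ l) ℤD.∣ a v i)) →
  (iv s e r : ℤ → ℕ) →
  (∀ v → iv (v ℤ.+ + τ) ≡ iv v) → (∀ v → s (v ℤ.+ + τ) ≡ s v) →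
  (∀ v → e (v ℤ.+ + τ) ≡ e v) → (∀ v → r (v ℤ.+ + τ) ≡ r v) →
  (∀ v → 1 ℕ.≤ iv v × iv v ℕ.< l) →
  (∀ v → 1 ℕ.≤ s v × s v ℕ.≤ m ^ f v ∸ 1 × Coprime (s v) m) →
  (∀ v → 1 ℕ.≤ e v × 1 ℕ.≤ r v) →
  (∀ v → (+ l) ℤD.∣ (+ r v ℤ.- + iv v)) →
  (∀ v → + (l ^ e v ℕ.* s v) ≡ + (m ^ f v ℕ.* r v) ℤ.+ a v (iv v)) →
  (∀ v → ℤ.∣ a v (iv v) ∣ ℕ.< (m ^ f v) ℕ.⊔ (l ^ e v)) →
  (n : ℤ → ℚ) → (∀ v → n (v ℤ.+ + τ) ≡ n v) → (∀ v → InR m l (n v)) →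
  (∀ v → CongR m l (m ^ f v) (n v) (ℕ→ℚ (s v))) →
  (∀ v → n (v ℤ.+ + 1) ≡
     ℕ→ℚ (l ^ e v) ℚ.* ((n v ℚ.- ℕ→ℚ (s v)) divℕ (m ^ f v)) ℚ.+ ℕ→ℚ (r v)) →
  (k : ℤ → ℕ → ℚ) (d : ℤ → ℕ → ℕ) →
  (∀ v → k v 0 ≡ n v) →
  (∀ v u → k v u ≡ ℕ→ℚ (m ^ f (v ℤ.+ + u)) ℚ.* k v (suc u) ℚ.+ ℕ→ℚ (d v u)
     × d v u ℕ.< m ^ f (v ℤ.+ + u) × InR m l (k v (suc u))) →
  (j : ℤ → ℕ → ℚ) (b : ℤ → ℕ → ℕ) →
  (∀ v → j v 0 ≡ n v) →
  (∀ v u → j v u ≡ ℕ→ℚ (l ^ e (v ℤ.- + 1 ℤ.- + u)) ℚ.* j v (suc u) ℚ.+ ℕ→ℚ (b v u)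
     × b v u ℕ.< l ^ e (v ℤ.- + 1 ℤ.- + u) × InR m l (j v (suc u))) →
  ∀ v → + 0 ℤ.≤ v → v ℤ.< + τ → ∀ u → 1 ℕ.≤ u →
    (Qadd m l f e s r d v u ℚ.- Qadd m l f e s r d (v ℤ.+ + 1) (u ∸ 1)
       ≡ ℕ→ℚ (l ^ sumFbar e (v ℤ.+ + u) (u ∸ 1)) ℚ.* ℕ→ℚ (b (v ℤ.+ + u ℤ.+ + 1) u))
    × (ℕ→ℚ (b (v ℤ.+ + u ℤ.+ + 1) u)
       ≡ (ℕ→ℚ (l ^ e v ℕ.* d v u) ℚ.- ℕ→ℚ (d (v ℤ.+ + 1) (u ∸ 1))
            ℚ.+ ℕ→ℚ (b (v ℤ.+ + u) (u ∸ 1))) divℕ (m ^ f (v ℤ.+ + u)))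
theorem4p1 m l τ m≥2 l≥2 _ _ f _ _ a _ _ a-conditions iv s e r _ _ _ _ iv-range s-range e,r≥1 _
  admissible |a|<max n _ n∈R n≡s n-step k d k₀ k-step j b j₀ j-step v _ _ (suc u) _ =
  Q-difference v u , b-recursion v u
  where
  m>0 : 0 ℕ.< m
  m>0 = ℕP.≤-trans (ℕ.s≤s ℕ.z≤n) m≥2
  l>0 : 0 ℕ.< l
  l>0 = ℕP.≤-trans (ℕ.s≤s ℕ.z≤n) l≥2
  l∣l^ : ∀ {x} → 1 ℕ.≤ x → l ℕD.∣ l ^ x
  l∣l^ {suc x} _ = ℕD.m∣m*n (l ^ x)
  s<m^f : ∀ w → s w ℕ.< m ^ f w
  s<m^f w = ℕP.m≤pred[n]⇒suc[m]≤n {{ℕP.m^n≢0 m (f w) {{ℕ.>-nonZero m>0}}}} (proj₁ (proj₂ (s-range w)))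
  r<l^e : ∀ w → r w ℕ.< l ^ e w
  r<l^e w = remainder-bound l (l ^ e w) (m ^ f w) (s w) (r w) (a w (iv w))
    (l∣l^ (proj₁ (e,r≥1 w))) (ℕP.m^n>0 l {{ℕ.>-nonZero l>0}} (e w)) (s<m^f w) (admissible w)
    (proj₂ (proj₂ (a-conditions w (iv w) (proj₁ (iv-range w)) (proj₂ (iv-range w))))) (|a|<max w)
  open Expansions m l m>0 f e s r s<m^f r<l^e n n∈R n≡s n-step k d k₀ k-step j b j₀ j-step
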